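{- Let $\mathbb H$ be a set of hypersequent rules and $\mathbb S$ a set of 2-systems such that $\textit{Sys}_{\textit{Hr}}\in\mathbb S$ for every $\textit{Hr}\in\mathbb H$. Let $\mathcal D$ be a derivation in $\mathrm{HLJ}+\mathbb H$ in structured form, and let $\widehat H_{\mathcal D}$ be the premiss of the uppermost application of external contraction in $\mathcal D$. Then for each component $C$ of $\widehat H_{\mathcal D}$ one can construct a partial derivation of $C$ in $\mathrm{LJ}+\mathbb S$ having the same structure as the ancestor tree of $C$ in $\mathcal D$, i.e. whose rule applications, apart from dummy rules (inferring a sequent $C'$ from several copies of $C'$), are exactly the translations of the rule applications of the ancestor tree of $C$ other than external weakening (rules of $\mathrm{HLJ}$ translated to the corresponding $\mathrm{LJ}$ rules, applications of $\textit{Hr}\in\mathbb H$ translated to the top rules of $\textit{Sys}_{\textit{Hr}}$).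
   Context: $\mathrm{LJ}$ is the propositional intuitionistic sequent calculus; $\mathrm{HLJ}$ is its hypersequent version (rules of $\mathrm{LJ}$ with shared hypersequent context $G$, plus external weakening (EW): from $G$ infer $G\mid C$, and external contraction (EC): from $G\mid C\mid C$ infer $G\mid C$). Hypersequent rules in $\mathbb H$ are external-context-sharing (premisses $G\mid C_j$, conclusion $G\mid H$) with exactly one active component $C_j$ in each premiss. A 2-system is a set of sequent rules with top rules $(r_1),\dots,(r_k)$ and bottom rule $(r_B)$, where $(r_B)$ infers $\Gamma\Rightarrow\Pi$ from $k$ copies of $\Gamma\Rightarrow\Pi$ and the top rules $(r_i)$ may only be applied (possibly several times) above the $i$-th premiss. For $\textit{Hr}$ with conclusion $G\mid D_1\mid\dots\mid D_k$ ($D_i=\Theta_i^1,\dots,\Theta_i^{n_i},\Gamma_i\Rightarrow\Pi_i$) and premisses partitioned into sets $M_1,\dots,M_k$, $M_i=\{G\mid C_i^1,\dots,G\mid C_i^{m_i}\}$, the 2-system $\textit{Sys}_{\textit{Hr}}$ has top rules $(r_i)$: from $C_i^1,\dots,C_i^{m_i}$ infer $D_i$; the premisses in $M_i$ are said to be linked to $D_i$. A partial derivation in $\mathrm{LJ}+\mathbb S$ is a derivation in $\mathrm{LJ}$ extended with the top rules of $\mathbb S$ without their applicability conditions relative to a bottom rule. A queue of a one-premiss rule $(r)$ is a maximal sequence of consecutive applications of $(r)$. A derivation in $\mathrm{HLJ}+\mathbb H$ is in structured form iff all (EC) applications occur in a queue immediately above the root, and all (EW) applications occur in queues directly above the premisses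 $G\mid C_1,\dots,G\mid C_n$ of some rule with more than one premiss and conclusion $G\mid C_0$, the queues starting from hypersequents $G_1\mid C_1,\dots,G_n\mid C_n$ such that each component of $G$ is contained in at least one of $G_1,\dots,G_n$. A component $C'$ is a parent of a component $C$ if: $C$ is active in the conclusion of an application of some $\textit{Hr}\in\mathbb H$ and $C'$ is the active component of a premiss linked to $C$; or $C$ is active in the conclusion of an $\mathrm{HLJ}$ rule and $C'$ is the active component of a premiss; or $C$ is a context component of a conclusion and $C'$ the corresponding context component in a premiss. The ancestor relation is the transitive closure of the parent relation; the ancestor tree of $C$ has as nodes the ancestors of $C$ (and $C$) and edges given by the parent relation. -}

module Defs where

open import Data.Nat using (ℕ)
open import Data.Fin using (Fin)
open import Data.Maybe using (Maybe; just; nothing)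
open import Data.List using (List; []; _∷_; [_]; _++_; _∷ʳ_; tabulate; concat; length)
open import Data.List.Membership.Propositional using (_∈_)
open import Data.List.Membership.Propositional.Properties using (∈-++⁻; ∈-++⁺ˡ; ∈-++⁺ʳ; ∈-tabulate⁻)
open import Data.List.Relation.Unary.Any using (here; there)
open import Data.List.Relation.Binary.Permutation.Propositional using (_↭_; ↭-sym)
open import Data.List.Relation.Binary.Permutation.Propositional.Properties using (∈-resp-↭)
open import Data.Product using (Σ; Σ-syntax; _×_; _,_; proj₁; proj₂; ∃)
open import Data.Sum using (_⊎_; inj₁; inj₂) renaming ([_,_]′ to either)
open import Data.Unit using (⊤)
open import Data.Empty using (⊥)
open import Data.Bool using (Bool; true; false)
open import Relation.Binary.PropositionalEquality using (_≡_; refl)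

infixr 6 _∧_
infixr 5 _∨_
infixr 4 _⊃_

data Fm : Set where
  atom : ℕ → Fm
  ⊥̇    : Fm
  _∧_  : Fm → Fm → Fm
  _∨_  : Fm → Fm → Fm
  _⊃_  : Fm → Fm → Fm

infix 3 _⇒_
record Seq : Set where
  constructor _⇒_
  field
    ant : List Fm        -- antecedent (a multiset, see _≈ˢ_)
    suc : Maybe Fm

_≈ˢ_ : Seq → Seq → Set
(Γ ⇒ Π) ≈ˢ (Δ ⇒ Σ′) = (Γ ↭ Δ) × (Π ≡ Σ′)

-- Rule₀ prem c : c follows from the
-- list of premisses prem; antecedent contexts are written as lists
-- and exchange is implicit via _≈ˢ_ on the conclusion (LJRule).

data Rule₀ : List Seq → Seq → Set where
  init : ∀ A → Rule₀ [] ([ A ] ⇒ just A)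
  ⊥L   : ∀ Π → Rule₀ [] ([ ⊥̇ ] ⇒ Π)
  WL   : ∀ A Γ Π → Rule₀ [ Γ ⇒ Π ] (A ∷ Γ ⇒ Π)
  WR   : ∀ A Γ → Rule₀ [ Γ ⇒ nothing ] (Γ ⇒ just A)
  CL   : ∀ A Γ Π → Rule₀ [ A ∷ A ∷ Γ ⇒ Π ] (A ∷ Γ ⇒ Π)
  ∧L₁  : ∀ A B Γ Π → Rule₀ [ A ∷ Γ ⇒ Π ] ((A ∧ B) ∷ Γ ⇒ Π)
  ∧L₂  : ∀ A B Γ Π → Rule₀ [ B ∷ Γ ⇒ Π ] ((A ∧ B) ∷ Γ ⇒ Π)
  ∧R   : ∀ A B Γ → Rule₀ ((Γ ⇒ just A) ∷ (Γ ⇒ just B) ∷ []) (Γ ⇒ just (A ∧ B))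
  ∨L   : ∀ A B Γ Π → Rule₀ ((A ∷ Γ ⇒ Π) ∷ (B ∷ Γ ⇒ Π) ∷ []) ((A ∨ B) ∷ Γ ⇒ Π)
  ∨R₁  : ∀ A B Γ → Rule₀ [ Γ ⇒ just A ] (Γ ⇒ just (A ∨ B))
  ∨R₂  : ∀ A B Γ → Rule₀ [ Γ ⇒ just B ] (Γ ⇒ just (A ∨ B))
  ⊃L   : ∀ A B Γ Δ Π → Rule₀ ((Γ ⇒ just A) ∷ (B ∷ Δ ⇒ Π) ∷ []) ((A ⊃ B) ∷ Γ ++ Δ ⇒ Π)
  ⊃R   : ∀ A B Γ → Rule₀ [ A ∷ Γ ⇒ just B ] (Γ ⇒ just (A ⊃ B))
  cut  : ∀ A Γ Δ Π → Rule₀ ((Γ ⇒ just A) ∷ (A ∷ Δ ⇒ Π) ∷ []) (Γ ++ Δ ⇒ Π)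

LJRule : List Seq → Seq → Set
LJRule prem c = Σ[ c₀ ∈ Seq ] (Rule₀ prem c₀ × (c₀ ≈ˢ c))

-- a hypersequent  C₁ | … | Cₙ  (a multiset of components, as a list;
-- a component occurrence is a membership proof  C ∈ H)
Hyp : Set
Hyp = List Seq

-- A hypersequent rule Hr (external-context-sharing, exactly one active
-- component per premiss), given by its set of instances: an instance
-- has conclusion  G | D₁ | … | D_k  and premisses partitioned into
-- M₁,…,M_k, where  M i  lists the active components  C_i^1 … C_i^{m_i}
-- of the premisses  G | C_i^j  linked to D_i.
record HRule : Set₁ where
  field
    arity : ℕ
    Inst  : (D : Fin arity → Seq) (M : Fin arity → List Seq) → Set
open HRule public

-- A 2-system: k top rules (r_1 … r_k), each a set of sequent-rule
-- instances (premisses, conclusion); the bottom rule infers Γ⇒Π from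
-- k copies of Γ⇒Π and is determined by k.
record TwoSystem : Set₁ where
  field
    tarity : ℕ
    Top    : Fin tarity → List Seq → Seq → Set
open TwoSystem public

Sys : HRule → TwoSystem
Sys R = record
  { tarity = arity R
  ; Top = λ i prem c → Σ[ D ∈ (Fin (arity R) → Seq) ] Σ[ M ∈ (Fin (arity R) → List Seq) ]
                         (Inst R D M × (M i ≡ prem) × (D i ≡ c)) }

allPrems : {k : ℕ} → (Fin k → List Seq) → List Seq
allPrems M = concat (tabulate M)

CtxOK : Hyp → ℕ → Set
CtxOK G n = n ≡ 0 → G ≡ []

mutual
  data Der (ℍ : HRule → Set) : Hyp → Set₁ where
    -- rule of LJ with shared context:  G|C_1 … G|C_n  /  G|C_0
    lj : (G : Hyp) (prem : List Seq) (C : Seq) → LJRule prem C →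
         CtxOK G (length prem) → Prems ℍ G prem → Der ℍ (G ∷ʳ C)
    -- application of Hr ∈ ℍ :  (G|C_i^j)_{i,j}  /  G|D_1|…|D_k
    hr : (R : HRule) → ℍ R → (G : Hyp) (D : Fin (arity R) → Seq)
         (M : Fin (arity R) → List Seq) → Inst R D M →
         CtxOK G (length (allPrems M)) →
         ((i : Fin (arity R)) → Prems ℍ G (M i)) → Der ℍ (G ++ tabulate D)
    ew : (G : Hyp) (C : Seq) → Der ℍ G → Der ℍ (G ∷ʳ C)
    ec : (G : Hyp) (C : Seq) (H : Hyp) → Der ℍ H → H ↭ (G ∷ʳ C ∷ʳ C) →
         Der ℍ (G ∷ʳ C)

  data PremD (ℍ : HRule → Set) (G : Hyp) (C : Seq) : Set₁ where
    prem : (H : Hyp) → Der ℍ H → H ↭ (G ∷ʳ C) → PremD ℍ G C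

  data Prems (ℍ : HRule → Set) (G : Hyp) : List Seq → Set₁ where
    []  : Prems ℍ G []
    _∷_ : {C : Seq} {Cs : List Seq} → PremD ℍ G C → Prems ℍ G Cs → Prems ℍ G (C ∷ Cs)

ctxPos : {G : Hyp} {C C' : Seq} {H : Hyp} → H ↭ (G ∷ʳ C) → C' ∈ G → C' ∈ H
ctxPos π q = ∈-resp-↭ (↭-sym π) (∈-++⁺ˡ q)

actPos : {G : Hyp} {C : Seq} {H : Hyp} → H ↭ (G ∷ʳ C) → C ∈ H
actPos {G} π = ∈-resp-↭ (↭-sym π) (∈-++⁺ʳ G (here refl))

-- Ancestor trees.  A node is a component occurrence, tagged by how it
-- arises; children = its parents (in premiss order).

data ATree : Set₁ where
  actLJ : (prem : List Seq) (C : Seq) → LJRule prem C → List ATree → ATree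
  actHr : (R : HRule) (D : Fin (arity R) → Seq) (M : Fin (arity R) → List Seq) →
          Inst R D M → (i : Fin (arity R)) → List ATree → ATree
  ctx   : Seq → List ATree → ATree
  ewNew : Seq → ATree
  ecAct : Seq → List ATree → ATree

mutual
  anc : {ℍ : HRule → Set} {H : Hyp} {C : Seq} → Der ℍ H → C ∈ H → ATree
  anc {C = C'} (lj G prm C ρ _ ps) p =
    either (λ q → ctx C' (ancCtx ps q)) (λ _ → actLJ prm C ρ (ancAct ps)) (∈-++⁻ G p)
  anc {C = C'} (hr R _ G D M ι _ ps) p =
    either (λ q → ctx C' (concat (tabulate (λ i → ancCtx (ps i) q))))
    (λ r → let i = proj₁ (∈-tabulate⁻ r) in actHr R D M ι i (ancAct (ps i))) (∈-++⁻ G p)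
  anc {C = C'} (ew G C d) p =
    either (λ q → ctx C' (anc d q ∷ [])) (λ _ → ewNew C) (∈-++⁻ G p)
  anc {C = C'} (ec G C H d π) p =
    either (λ q → ctx C' (anc d (∈-resp-↭ (↭-sym π) (∈-++⁺ˡ (∈-++⁺ˡ q))) ∷ []))
    (λ _ → ecAct C ( anc d (∈-resp-↭ (↭-sym π) (∈-++⁺ˡ (∈-++⁺ʳ G (here refl))))
                     ∷ anc d (∈-resp-↭ (↭-sym π) (∈-++⁺ʳ (G ∷ʳ C) (here refl)))
                     ∷ [])) (∈-++⁻ G p)

  ancCtx : {ℍ : HRule → Set} {G : Hyp} {Cs : List Seq} {C' : Seq} →
           Prems ℍ G Cs → C' ∈ G → List ATree
  ancCtx [] q = []
  ancCtx (prem H d π ∷ ps) q = anc d (ctxPos π q) ∷ ancCtx ps q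

  ancAct : {ℍ : HRule → Set} {G : Hyp} {Cs : List Seq} → Prems ℍ G Cs → List ATree
  ancAct [] = []
  ancAct (prem H d π ∷ ps) = anc d (actPos π) ∷ ancAct ps

-- an occurrence is genuine if it is not introduced by the EW-queue
-- directly above it (i.e. it lies in the hypersequent G_i|C_i where
-- the queue starts)
Genuine : {ℍ : HRule → Set} {H : Hyp} {C : Seq} → Der ℍ H → C ∈ H → Set
Genuine (ew G C d) p = either (λ q → Genuine d q) (λ _ → ⊥) (∈-++⁻ G p)
Genuine (lj _ _ _ _ _ _) p = ⊤
Genuine (hr _ _ _ _ _ _ _ _) p = ⊤
Genuine (ec _ _ _ _ _) p = ⊤

multi : List Seq → Bool
multi (_ ∷ _ ∷ _) = true
multi _ = false

-- for multi-premiss rules: every component of G is contained in one of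
-- the G_i (where the EW-queues start)
MultiCtx : Bool → (G : Hyp) → ({C' : Seq} → C' ∈ G → Set) → Set
MultiCtx false G P = ⊤
MultiCtx true G P = {C' : Seq} (q : C' ∈ G) → P q

mutual
  -- structured derivation not containing EC; EW only in queues
  -- directly above premisses of rules with more than one premiss
  SF : {ℍ : HRule → Set} {H : Hyp} → Der ℍ H → Set
  SF (lj G prm C ρ _ ps) = SFnode (multi prm) ps × MultiCtx (multi prm) G (λ q → AnyGen ps q)
  SF (hr R _ G D M ι _ ps) =
    ((i : Fin (arity R)) → SFnode (multi (allPrems M)) (ps i)) ×
    MultiCtx (multi (allPrems M)) G (λ q → Σ[ i ∈ Fin (arity R) ] AnyGen (ps i) q)
  SF (ew _ _ _) = ⊥
  SF (ec _ _ _ _ _) = ⊥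

  SFq : {ℍ : HRule → Set} {H : Hyp} → Der ℍ H → Set
  SFq (ew G C d) = SFq d
  SFq d@(lj _ _ _ _ _ _) = SF d
  SFq d@(hr _ _ _ _ _ _ _ _) = SF d
  SFq (ec _ _ _ _ _) = ⊥

  -- premisses of a node: for multi-premiss rules, each premiss is an
  -- EW-queue over an SF derivation starting from G_i|C_i (so the active
  -- C_i is genuine); otherwise no EW directly above
  SFnode : {ℍ : HRule → Set} {G : Hyp} {Cs : List Seq} → Bool → Prems ℍ G Cs → Set
  SFnode b [] = ⊤
  SFnode true (prem H d π ∷ ps) = (SFq d × Genuine d (actPos π)) × SFnode true ps
  SFnode false (prem H d π ∷ ps) = SF d × SFnode false ps

  AnyGen : {ℍ : HRule → Set} {G : Hyp} {Cs : List Seq} {C' : Seq} →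
           Prems ℍ G Cs → C' ∈ G → Set
  AnyGen [] q = ⊥
  AnyGen (prem H d π ∷ ps) q = Genuine d (ctxPos π q) ⊎ AnyGen ps q

-- all EC applications form a queue immediately above the root
Structured : {ℍ : HRule → Set} {H : Hyp} → Der ℍ H → Set
Structured (ec G C H d π) = Structured d
Structured d@(lj _ _ _ _ _ _) = SF d
Structured d@(hr _ _ _ _ _ _ _ _) = SF d
Structured (ew _ _ _) = ⊥

RootEC : {ℍ : HRule → Set} {H : Hyp} → Der ℍ H → Set
RootEC (ec _ _ _ _ _) = ⊤
RootEC (lj _ _ _ _ _ _) = ⊥
RootEC (hr _ _ _ _ _ _ _ _) = ⊥
RootEC (ew _ _ _) = ⊥

-- strip the EC-queue at the root: for a derivation whose root is EC this
-- is the derivation of Ĥ_D, the premiss of the uppermost EC application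
aboveEC : {ℍ : HRule → Set} {H : Hyp} → Der ℍ H → Σ[ H' ∈ Hyp ] Der ℍ H'
aboveEC (ec _ _ H d _) = aboveEC d
aboveEC {H = H} d@(lj _ _ _ _ _ _) = H , d
aboveEC {H = H} d@(hr _ _ _ _ _ _ _ _) = H , d
aboveEC {H = H} d@(ew _ _ _) = H , d

-- Partial derivations in LJ + 𝕊 (𝕊 : set of 2-systems): LJ rules, top
-- rules of the 2-systems in 𝕊 (no applicability conditions), and dummy
-- rules inferring C from n ≥ 1 copies of C.

mutual
  data PD (𝕊 : TwoSystem → Set) : Seq → Set₁ where
    ljP    : (prem : List Seq) (C : Seq) → LJRule prem C → PDs 𝕊 prem → PD 𝕊 C
    topP   : (S : TwoSystem) → 𝕊 S → (i : Fin (tarity S)) (prem : List Seq) (C : Seq) →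
             Top S i prem C → PDs 𝕊 prem → PD 𝕊 C
    dummyP : (C : Seq) (n : ℕ) → PDs 𝕊 (C ∷ copies n C) → PD 𝕊 C

  data PDs (𝕊 : TwoSystem → Set) : List Seq → Set₁ where
    []  : PDs 𝕊 []
    _∷_ : {C : Seq} {Cs : List Seq} → PD 𝕊 C → PDs 𝕊 Cs → PDs 𝕊 (C ∷ Cs)

  copies : ℕ → Seq → List Seq
  copies ℕ.zero C = []
  copies (ℕ.suc n) C = C ∷ copies n C

-- Rule-application skeletons (trees of rule labels), used to compare
-- structures modulo dummy rules / context passages / EW.

data Label : Set₁ where
  ljL  : (prem : List Seq) (C : Seq) → LJRule prem C → Label
  topL : (S : TwoSystem) (i : Fin (tarity S)) (prem : List Seq) (C : Seq) → Label
  ecL  : Seq → Label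

data RTree : Set₁ where
  node : Label → List RTree → RTree

-- translation of the ancestor tree: HLJ rules ↦ LJ rules, Hr ↦ top rule
-- r_i of Sys_Hr; context passages contribute no rule application;
-- EW-introduced occurrences are dropped
mutual
  skelA : ATree → List RTree
  skelA (actLJ prm C ρ ts) = node (ljL prm C ρ) (skelAs ts) ∷ []
  skelA (actHr R D M ι i ts) = node (topL (Sys R) i (M i) (D i)) (skelAs ts) ∷ []
  skelA (ctx C ts) = skelAs ts
  skelA (ewNew C) = []
  skelA (ecAct C ts) = node (ecL C) (skelAs ts) ∷ []

  skelAs : List ATree → List RTree
  skelAs [] = []
  skelAs (t ∷ ts) = skelA t ++ skelAs ts

mutual
  skelP : {𝕊 : TwoSystem → Set} {C : Seq} → PD 𝕊 C → List RTree
  skelP (ljP prm C ρ ps) = node (ljL prm C ρ) (skelPs ps) ∷ []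
  skelP (topP S _ i prm C _ ps) = node (topL S i prm C) (skelPs ps) ∷ []
  skelP (dummyP C n ps) = skelPs ps

  skelPs : {𝕊 : TwoSystem → Set} {Cs : List Seq} → PDs 𝕊 Cs → List RTree
  skelPs [] = []
  skelPs (p ∷ ps) = skelP p ++ skelPs ps

{-# OPTIONS --safe #-}
-- The ancestor tree of a component is translated bottom-up: an HLJ rule
-- becomes its LJ rule, an application of Hr the corresponding top rule of
-- Sys_Hr, and a context component of a rule with several premisses becomes
-- a dummy rule over the translations of its parents in all premisses.
-- Parents introduced by an EW queue (the non-genuine occurrences) have an
-- empty skeleton and are dropped.  Structured form is exactly what makes
-- the dummy rule legal: every context component is genuine in at least one
-- premiss (by definition for rules with several premisses; otherwise there
-- is no EW directly above, and CtxOK rules out a context without premisses).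
module Submission where

open import Defs
open import Data.List.Membership.Propositional using (_∈_)
open import Data.Product using (Σ; proj₁; proj₂)
open import Relation.Binary.PropositionalEquality using (_≡_)

open import Data.Bool using (Bool; true; false)
open import Data.Empty using (⊥-elim)
open import Data.Fin using (Fin; zero; suc)
open import Data.List using (List; []; _∷_; _++_; _∷ʳ_; concat; concatMap; tabulate; length)
open import Data.List.Properties using (++-assoc; ++-identityʳ; concatMap-++)
open import Data.List.Membership.Propositional.Properties using (∈-++⁻; ∈-tabulate⁻)
open import Data.List.Relation.Binary.Permutation.Propositional using (_↭_)
open import Data.List.Relation.Unary.Any using (Any; here)
open import Data.List.Relation.Unary.Any.Properties using (concat⁺; concat⁻; tabulate⁺; tabulate⁻)
open import Data.Nat using (ℕ)
open import Data.Product using (_×_; _,_)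
open import Data.Sum using (inj₁; inj₂)
open import Data.Unit using (⊤; tt)
open import Function using (_∘_)
open import Level using (Level)
open import Relation.Nullary using (Dec; yes; no; ¬_)
open import Relation.Binary.PropositionalEquality using (refl; sym; trans; cong; cong₂; module ≡-Reasoning)

NonEmpty : {a : Level} {A : Set a} → List A → Set a
NonEmpty = Any (λ _ → ⊤)

skelAs-++ : (ts us : List ATree) → skelAs (ts ++ us) ≡ skelAs ts ++ skelAs us
skelAs-++ []       us = refl
skelAs-++ (t ∷ ts) us =
  trans (cong (skelA t ++_) (skelAs-++ ts us)) (sym (++-assoc (skelA t) (skelAs ts) (skelAs us)))

module _ {ℍ : HRule → Set} where

  SF⇒SFq : {H : Hyp} (d : Der ℍ H) → SF d → SFq d
  SF⇒SFq (lj _ _ _ _ _ _)     sf = sf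
  SF⇒SFq (hr _ _ _ _ _ _ _ _) sf = sf

  SF⇒Genuine : {H : Hyp} (d : Der ℍ H) → SF d → {C : Seq} (p : C ∈ H) → Genuine d p
  SF⇒Genuine (lj _ _ _ _ _ _)     _ _ = tt
  SF⇒Genuine (hr _ _ _ _ _ _ _ _) _ _ = tt

  genuine? : {H : Hyp} (d : Der ℍ H) {C : Seq} (p : C ∈ H) → Dec (Genuine d p)
  genuine? (lj _ _ _ _ _ _)     _ = yes tt
  genuine? (hr _ _ _ _ _ _ _ _) _ = yes tt
  genuine? (ec _ _ _ _ _)       _ = yes tt
  genuine? (ew G C d) p with ∈-++⁻ G p
  ... | inj₁ q = genuine? d q
  ... | inj₂ _ = no λ ()

  ¬Genuine⇒skelA-anc≡[] : {H : Hyp} (d : Der ℍ H) {C : Seq} (p : C ∈ H) →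
                          ¬ Genuine d p → skelA (anc d p) ≡ []
  ¬Genuine⇒skelA-anc≡[] (lj _ _ _ _ _ _)     _ ng = ⊥-elim (ng tt)
  ¬Genuine⇒skelA-anc≡[] (hr _ _ _ _ _ _ _ _) _ ng = ⊥-elim (ng tt)
  ¬Genuine⇒skelA-anc≡[] (ec _ _ _ _ _)       _ ng = ⊥-elim (ng tt)
  ¬Genuine⇒skelA-anc≡[] (ew G C d) p ng with ∈-++⁻ G p
  ... | inj₁ q = trans (++-identityʳ _) (¬Genuine⇒skelA-anc≡[] d q ng)
  ... | inj₂ _ = refl

  SFnode-head : (b : Bool) {G H : Hyp} {C : Seq} {Cs : List Seq} {d : Der ℍ H}
                {π : H ↭ (G ∷ʳ C)} {ps : Prems ℍ G Cs} →
                SFnode b (prem H d π ∷ ps) → (SFq d × Genuine d (actPos π)) × SFnode b ps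
  SFnode-head true          (head , rest) = head , rest
  SFnode-head false {d = d} (sf , rest)   = (SF⇒SFq d sf , SF⇒Genuine d sf _) , rest

  CtxOK⇒NonEmpty : {G : Hyp} {Cs : List Seq} {C' : Seq} →
                   CtxOK G (length Cs) → C' ∈ G → NonEmpty Cs
  CtxOK⇒NonEmpty {Cs = []} ok q with ok refl
  CtxOK⇒NonEmpty {Cs = []} ok () | refl
  CtxOK⇒NonEmpty {Cs = _ ∷ _} _ _ = here tt

  SFnode-false⇒AnyGen : {G : Hyp} {Cs : List Seq} (ps : Prems ℍ G Cs) → SFnode false ps →
                        NonEmpty Cs → {C' : Seq} (q : C' ∈ G) → AnyGen ps q
  SFnode-false⇒AnyGen (prem H d π ∷ _) (sf , _) _ q = inj₁ (SF⇒Genuine d sf (ctxPos π q))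

  ljContext-AnyGen : (b : Bool) {G : Hyp} {Cs : List Seq} (ps : Prems ℍ G Cs) → SFnode b ps →
                     MultiCtx b G (AnyGen ps) → CtxOK G (length Cs) →
                     {C' : Seq} (q : C' ∈ G) → AnyGen ps q
  ljContext-AnyGen true  ps _   anyGen _  q = anyGen q
  ljContext-AnyGen false ps sfn _      ok q = SFnode-false⇒AnyGen ps sfn (CtxOK⇒NonEmpty ok q) q

  hrContext-AnyGen : (b : Bool) {k : ℕ} {G : Hyp} (M : Fin k → List Seq)
                     (ps : (i : Fin k) → Prems ℍ G (M i)) → ((i : Fin k) → SFnode b (ps i)) →
                     MultiCtx b G (λ q → Σ (Fin k) λ i → AnyGen (ps i) q) →
                     CtxOK G (length (allPrems M)) →
                     {C' : Seq} (q : C' ∈ G) → Σ (Fin k) λ i → AnyGen (ps i) q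
  hrContext-AnyGen true  M ps _    anyGen _  q = anyGen q
  hrContext-AnyGen false M ps sfns _      ok q =
    let i , ne = tabulate⁻ (concat⁻ (tabulate M) (CtxOK⇒NonEmpty ok q))
    in  i , SFnode-false⇒AnyGen (ps i) (sfns i) ne q

module Translation (ℍ : HRule → Set) (𝕊 : TwoSystem → Set)
                   (sys∈𝕊 : (R : HRule) → ℍ R → 𝕊 (Sys R)) where

  PDOfShape : Seq → List RTree → Set₁
  PDOfShape C s = Σ (PD 𝕊 C) λ 𝒫 → skelP 𝒫 ≡ s

  copiesPDs : {C : Seq} (𝒫s : List (PD 𝕊 C)) → PDs 𝕊 (copies (length 𝒫s) C)
  copiesPDs []       = []
  copiesPDs (𝒫 ∷ 𝒫s) = 𝒫 ∷ copiesPDs 𝒫s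

  skelPs-copiesPDs : {C : Seq} (𝒫s : List (PD 𝕊 C)) → skelPs (copiesPDs 𝒫s) ≡ concatMap skelP 𝒫s
  skelPs-copiesPDs []       = refl
  skelPs-copiesPDs (𝒫 ∷ 𝒫s) = cong (skelP 𝒫 ++_) (skelPs-copiesPDs 𝒫s)

  joinByDummy : {C : Seq} {s : List RTree} (𝒫s : List (PD 𝕊 C)) → NonEmpty 𝒫s →
                concatMap skelP 𝒫s ≡ s → PDOfShape C s
  joinByDummy {C} (𝒫 ∷ 𝒫s) _ eq =
    dummyP C (length 𝒫s) (𝒫 ∷ copiesPDs 𝒫s) , trans (cong (skelP 𝒫 ++_) (skelPs-copiesPDs 𝒫s)) eq

  skelP-concat-tabulate : (k : ℕ) {C : Seq} (𝒫ss : Fin k → List (PD 𝕊 C)) (tss : Fin k → List ATree) →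
                          ((i : Fin k) → concatMap skelP (𝒫ss i) ≡ skelAs (tss i)) →
                          concatMap skelP (concat (tabulate 𝒫ss)) ≡ skelAs (concat (tabulate tss))
  skelP-concat-tabulate ℕ.zero    𝒫ss tss eqs = refl
  skelP-concat-tabulate (ℕ.suc k) 𝒫ss tss eqs = begin
    concatMap skelP (𝒫ss zero ++ concat (tabulate (𝒫ss ∘ suc)))
      ≡⟨ concatMap-++ skelP (𝒫ss zero) _ ⟩
    concatMap skelP (𝒫ss zero) ++ concatMap skelP (concat (tabulate (𝒫ss ∘ suc)))
      ≡⟨ cong₂ _++_ (eqs zero) (skelP-concat-tabulate k (𝒫ss ∘ suc) (tss ∘ suc) (eqs ∘ suc)) ⟩
    skelAs (tss zero) ++ skelAs (concat (tabulate (tss ∘ suc)))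
      ≡⟨ skelAs-++ (tss zero) _ ⟨
    skelAs (tss zero ++ concat (tabulate (tss ∘ suc))) ∎
    where open ≡-Reasoning

  record ContextTranslation {G : Hyp} {Cs : List Seq} (ps : Prems ℍ G Cs)
                            {C' : Seq} (q : C' ∈ G) : Set₁ where
    field
      derivations : List (PD 𝕊 C')
      skeleton    : concatMap skelP derivations ≡ skelAs (ancCtx ps q)
      nonEmpty    : AnyGen ps q → NonEmpty derivations
  open ContextTranslation

  mutual
    translate : {H : Hyp} (d : Der ℍ H) → SFq d → {C : Seq} (p : C ∈ H) → Genuine d p →
                PDOfShape C (skelA (anc d p))
    translate (ew G C d) sfq p g with ∈-++⁻ G p
    ... | inj₁ q = let 𝒫 , eq = translate d sfq q g in 𝒫 , trans eq (sym (++-identityʳ _))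
    translate (lj G prm C ρ ok ps) (sfn , anyGen) p _ with ∈-++⁻ G p
    ... | inj₁ q =
      let T = translateContext (multi prm) ps sfn q
      in  joinByDummy (derivations T) (nonEmpty T (ljContext-AnyGen _ ps sfn anyGen ok q)) (skeleton T)
    ... | inj₂ (here refl) =
      let 𝒫s , eq = translatePremisses (multi prm) ps sfn
      in  ljP prm C ρ 𝒫s , cong (λ ts → node (ljL prm C ρ) ts ∷ []) eq
    translate (hr R hR G D M ι ok ps) (sfns , anyGen) p _ with ∈-++⁻ G p
    ... | inj₁ q =
      let T  = λ i → translateContext (multi (allPrems M)) (ps i) (sfns i) q
          i , a = hrContext-AnyGen _ M ps sfns anyGen ok q
      in  joinByDummy (concat (tabulate (derivations ∘ T))) (concat⁺ (tabulate⁺ i (nonEmpty (T i) a)))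
            (skelP-concat-tabulate (arity R) (derivations ∘ T) (λ i → ancCtx (ps i) q) (skeleton ∘ T))
    ... | inj₂ r with ∈-tabulate⁻ r
    ... | i , refl =
      let 𝒫s , eq = translatePremisses (multi (allPrems M)) (ps i) (sfns i)
      in  topP (Sys R) (sys∈𝕊 R hR) i (M i) (D i) (D , M , ι , refl , refl) 𝒫s ,
          cong (λ ts → node (topL (Sys R) i (M i) (D i)) ts ∷ []) eq

    translatePremisses : (b : Bool) {G : Hyp} {Cs : List Seq} (ps : Prems ℍ G Cs) → SFnode b ps →
                         Σ (PDs 𝕊 Cs) λ 𝒫s → skelPs 𝒫s ≡ skelAs (ancAct ps)
    translatePremisses b []                 _   = [] , refl
    translatePremisses b (prem H d π ∷ ps) sfn =
      let (sfq , g) , sfn′ = SFnode-head b sfn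
          𝒫 , eq   = translate d sfq (actPos π) g
          𝒫s , eqs = translatePremisses b ps sfn′
      in  𝒫 ∷ 𝒫s , cong₂ _++_ eq eqs

    translateContext : (b : Bool) {G : Hyp} {Cs : List Seq} (ps : Prems ℍ G Cs) → SFnode b ps →
                       {C' : Seq} (q : C' ∈ G) → ContextTranslation ps q
    translateContext b [] _ q = record { derivations = [] ; skeleton = refl ; nonEmpty = λ () }
    translateContext b (prem H d π ∷ ps) sfn q with SFnode-head b sfn | genuine? d (ctxPos π q)
    ... | (sfq , _) , sfn′ | yes g =
      let 𝒫 , eq = translate d sfq (ctxPos π q) g
          T      = translateContext b ps sfn′ q
      in  record { derivations = 𝒫 ∷ derivations T
                 ; skeleton    = cong₂ _++_ eq (skeleton T)
                 ; nonEmpty    = λ _ → here tt }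
    ... | _ , sfn′ | no ng =
      let T = translateContext b ps sfn′ q
      in  record { derivations = derivations T
                 ; skeleton    = trans (skeleton T)
                                   (cong (_++ skelAs (ancCtx ps q)) (sym (¬Genuine⇒skelA-anc≡[] d _ ng)))
                 ; nonEmpty    = λ { (inj₁ g) → ⊥-elim (ng g) ; (inj₂ a) → nonEmpty T a } }

  translate-aboveEC : {H : Hyp} (d : Der ℍ H) → Structured d → {C : Seq} (c : C ∈ proj₁ (aboveEC d)) →
                      PDOfShape C (skelA (anc (proj₂ (aboveEC d)) c))
  translate-aboveEC (ec _ _ _ d _)         st c = translate-aboveEC d st c
  translate-aboveEC d@(lj _ _ _ _ _ _)     st c = translate d st c tt
  translate-aboveEC d@(hr _ _ _ _ _ _ _ _) st c = translate d st c tt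

lemma3 : (ℍ : HRule → Set) (𝕊 : TwoSystem → Set) →
         ((R : HRule) → ℍ R → 𝕊 (Sys R)) →
         {H : Hyp} (𝒟 : Der ℍ H) → Structured 𝒟 → RootEC 𝒟 →
         {C : Seq} (c : C ∈ proj₁ (aboveEC 𝒟)) →
         Σ (PD 𝕊 C) (λ 𝒫 → skelP 𝒫 ≡ skelA (anc (proj₂ (aboveEC 𝒟)) c))
lemma3 ℍ 𝕊 sys∈𝕊 𝒟 structured _ c = Translation.translate-aboveEC ℍ 𝕊 sys∈𝕊 𝒟 structured c
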